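{- Let $G=(V,E,L)$ be a looped simple graph and let $f_0$ (with integer $t\geq 1$), $f_1$ and $f_1^D$ (with integer $t\geq 2$) be the functions defined below. For $i\in\{0,1\}$ put $\mathcal{I}_{f_i}=\{T\subseteq E\cup L: |I|\leq f_i(I)\text{ for all }I\subseteq T\}$. Then $(E\cup L,\mathcal{I}_{f_i})$ is a matroid, with rank function $\hat f_0(T)=\min\{|T'|+f_0(T\setminus T'):T'\subseteq T\}$ for $i=0$, and $$\hat f_1(T)=\min\{|T'|+f_1^D(T\setminus T'):T'\subseteq T\}=\min\Big\{|T'|+\sum_{j=0}^k f_1(T_j): T'\subseteq T,\ \{T_0,\ldots,T_k\}\text{ a partition of }T\setminus T'\Big\}$$ for $i=1$.
   Context: A looped simple graph $G=(V,E,L)$ has vertex set $V$, simple edges $E$ (no multiple edges) and loops $L$. For $T\subseteq E\cup L$, $V(T)$ is the set of vertices incident to members of $T$. For a positive integer $t$, $f_0(T)=t|V(T)|$. For an integer $t>1$, $f_1(T)=|T|$ if $T\subseteq E$ and $|V(T)|\leq 2t$; $f_1(T)=t|V(T)|-1$ if $T\subseteq E$ and $|V(T)|=2t+1$; $f_1(T)=t|V(T)|$ if ($T\subseteq E$ and $|V(T)|\geq 2t+2$) or $T\cap L\neq\emptyset$. The Dilworth truncation is $f_1^D(T)=\min\{\sum_{j=1}^k f_1(T_j):\{T_1,\ldots,T_k\}\text{ a partition of }T\}$. -}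

module Defs where

open import Data.Nat using (ℕ; zero; suc; _+_; _*_; _∸_; _≤_; _<_; _≤ᵇ_)
open import Data.Nat.Properties using ()
open import Data.Bool using (Bool; true; false; _∧_; _∨_; if_then_else_)
open import Data.Fin using (Fin; zero; suc; _≟_)
open import Data.Fin.Subset using (Subset; _∈_; _∉_; _⊆_; _∩_; _∪_; _─_; ∣_∣; ⁅_⁆; ⊥)
open import Data.Vec using (Vec; tabulate; lookup)
open import Data.Product using (Σ; _×_; _,_; ∃)
open import Function.Definitions using (Injective)
open import Relation.Binary.PropositionalEquality using (_≡_)
open import Relation.Nullary.Decidable using (⌊_⌋)

anyFin : ∀ {m} → (Fin m → Bool) → Bool
anyFin {zero}  p = false
anyFin {suc m} p = p zero ∨ anyFin (λ i → p (suc i))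

allFin : ∀ {m} → (Fin m → Bool) → Bool
allFin {zero}  p = true
allFin {suc m} p = p zero ∧ allFin (λ i → p (suc i))

sumFin : ∀ {m} → (Fin m → ℕ) → ℕ
sumFin {zero}  f = 0
sumFin {suc m} f = f zero + sumFin (λ i → f (suc i))

-- a member of E ∪ L: a loop at a vertex, or a simple edge uv with u ≠ v
-- (stored with u < v, so that an unordered pair has one representation)
data Link (n : ℕ) : Set where
  loop : Fin n → Link n
  edge : (u v : Fin n) → Data.Fin._<_ u v → Link n

record LoopedSimpleGraph (n m : ℕ) : Set where
  field
    link     : Fin m → Link n
    -- distinct elements of E ∪ L are distinct edges/loops
    -- (no multiple edges, at most one loop per vertex)
    link-inj : Injective _≡_ _≡_ link
open LoopedSimpleGraph public

module _ {n m : ℕ} (G : LoopedSimpleGraph n m) where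

  incident : Link n → Fin n → Bool
  incident (loop w)     x = ⌊ w ≟ x ⌋
  incident (edge u v _) x = ⌊ u ≟ x ⌋ ∨ ⌊ v ≟ x ⌋

  isLoop : Link n → Bool
  isLoop (loop _)     = true
  isLoop (edge _ _ _) = false

  VT : Subset m → Subset n
  VT T = tabulate λ x → anyFin λ e → lookup T e ∧ incident (link G e) x

  hasLoop : Subset m → Bool
  hasLoop T = anyFin λ e → lookup T e ∧ isLoop (link G e)

  f₀ : ℕ → Subset m → ℕ
  f₀ t T = t * ∣ VT T ∣

  f₁ : ℕ → Subset m → ℕ
  f₁ t T with hasLoop T
  ... | true  = t * ∣ VT T ∣
  ... | false =
    if ∣ VT T ∣ ≤ᵇ 2 * t then ∣ T ∣
    else if ∣ VT T ∣ ≤ᵇ 2 * t + 1 then t * ∣ VT T ∣ ∸ 1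
    else t * ∣ VT T ∣

-- Partitions of S ⊆ Fin m, encoded by a block labelling Fin m → Fin m:
-- block j = S ∩ {e | label e = j}.  (Every partition of S has ≤ m blocks;
-- empty blocks may occur, which is harmless since f(∅) = 0 for f₀, f₁.)

block : ∀ {m} → Subset m → (Fin m → Fin m) → Fin m → Subset m
block S lab j = S ∩ tabulate (λ e → ⌊ lab e ≟ j ⌋)

partSum : ∀ {m} → (Subset m → ℕ) → Subset m → (Fin m → Fin m) → ℕ
partSum f S lab = sumFin λ j → f (block S lab j)

IsDilworth : ∀ {m} → (Subset m → ℕ) → Subset m → ℕ → Set
IsDilworth f S d =
  (∃ λ lab → d ≡ partSum f S lab) × (∀ lab → d ≤ partSum f S lab)

IsMatroid : ∀ {m} → (Subset m → Set) → Set
IsMatroid {m} I =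
  I ⊥ ×
  (∀ A B → B ⊆ A → I A → I B) ×
  (∀ A B → I A → I B → ∣ A ∣ < ∣ B ∣ →
     ∃ λ e → e ∈ B × e ∉ A × I (A ∪ ⁅ e ⁆))

IsRank : ∀ {m} → (Subset m → Set) → Subset m → ℕ → Set
IsRank I T r =
  (∃ λ A → A ⊆ T × I A × ∣ A ∣ ≡ r) ×
  (∀ A → A ⊆ T → I A → ∣ A ∣ ≤ r)

Indep : ∀ {m} → (Subset m → ℕ) → Subset m → Set
Indep f T = ∀ I → I ⊆ T → ∣ I ∣ ≤ f I

IsHat : ∀ {m} → (Subset m → ℕ) → Subset m → ℕ → Set
IsHat f T h =
  (∃ λ T' → T' ⊆ T × h ≡ ∣ T' ∣ + f (T ─ T')) ×
  (∀ T' → T' ⊆ T → h ≤ ∣ T' ∣ + f (T ─ T'))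

IsHatD : ∀ {m} → (Subset m → ℕ) → Subset m → ℕ → Set
IsHatD f T h =
  (∃ λ T' → T' ⊆ T × ∃ λ d → IsDilworth f (T ─ T') d × h ≡ ∣ T' ∣ + d) ×
  (∀ T' → T' ⊆ T → ∀ d → IsDilworth f (T ─ T') d → h ≤ ∣ T' ∣ + d)

IsHatPart : ∀ {m} → (Subset m → ℕ) → Subset m → ℕ → Set
IsHatPart f T h =
  (∃ λ T' → T' ⊆ T × ∃ λ lab → h ≡ ∣ T' ∣ + partSum f (T ─ T') lab) ×
  (∀ T' → T' ⊆ T → ∀ lab → h ≤ ∣ T' ∣ + partSum f (T ─ T') lab)

-- Edmonds' argument for matroids induced by count functions.  Let f be monotone with
-- f(∅) = 0 and submodular on intersecting pairs of sets X with f(X) < |X|.  Every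
-- independent B ⊆ T satisfies |B| ≤ |T′| + Σⱼ f(Tⱼ) for any T′ ⊆ T and partition of
-- T ∖ T′.  For equality take A ⊆ T independent and maximal: each e ∈ T ∖ A lies in a
-- tight set X ⊆ T, f(X) ≤ |X ∩ A|.  Tight sets leaving A violate the count, so two of
-- them that meet have a tight union; hence the largest tight sets through the e ∈ T ∖ A
-- partition their union U, and T′ = A ∖ U attains |A|.  Applied to T = A ∪ B this is
-- the augmentation axiom.  A partition attaining the minimum is optimal for T ∖ T′, which
-- gives the form with the Dilworth truncation f^D.
--
-- f₀ = t·|V(·)| is submodular, and subadditive over partitions, so no partition is needed
-- in its rank formula.  A set violating f₁ has f₁(X) = t·|V(X)|, or f₁(X) = t·|V(X)| − 1
-- with X loopless and |V(X)| = 2t + 1; since a loopless X has at most (|V(X)| choose 2)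
-- edges, f₁(X) + 2 ≤ t·|V(X)| for nonempty loopless X with |V(X)| ≤ 2t, and these gaps
-- absorb the defects in t·|V(·)|-submodularity.

module Submission where

open import Data.Bool using (Bool; true; false; _∧_; if_then_else_)
open import Data.Bool.Properties using (∧-comm; ∨-zeroʳ; ⇔→≡)
open import Data.Empty using (⊥-elim)
open import Data.Fin using (Fin; zero; suc; _≟_) renaming (_<_ to _<ᶠ_)
import Data.Fin.Properties as Fin
open import Data.Fin.Subset using (Subset; outside; inside; _∈_; _∉_; _⊆_; _∩_; _∪_; _─_; ∣_∣; ⁅_⁆; ⊥; Nonempty; ⋃)
open import Data.Fin.Subset.Properties
import Data.List as List
open import Data.Maybe using (Maybe; just; nothing; is-just; fromMaybe)
import Data.Maybe as Maybe
open import Data.Nat using (ℕ; zero; suc; _+_; _*_; _≤_; _<_; z≤n; s≤s; _≤ᵇ_; _<?_; _≤?_)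
open import Data.Nat.Properties hiding (_≟_)
open import Algebra.Properties.CommutativeSemigroup +-commutativeSemigroup using (interchange; xy∙z≈xz∙y)
open import Algebra.Properties.Semiring.Sum +-*-semiring
  using (sum-syntax; ∑-comm; ∑-distrib-+; sum-cong-≗; sum-replicate-zero; *-distribˡ-sum; *-distribʳ-sum)
open import Data.Product using (Σ; _×_; _,_; ∃; proj₁; proj₂)
open import Data.Sum using (_⊎_; inj₁; inj₂)
open import Data.Vec using ([]; _∷_; tabulate; lookup; here; there)
open import Data.Vec.Properties using (lookup∘tabulate; lookup-zipWith; []=⇒lookup; lookup⇒[]=)
open import Function using (_∘_)
open import Function.Bundles using (mk⇔)
open import Relation.Binary.Definitions using (tri<; tri≈; tri>)
open import Relation.Binary.PropositionalEquality
open import Relation.Nullary using (¬_; yes; no; Dec; ¬?)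
open import Relation.Nullary.Decidable using (⌊_⌋; ⌊⌋-map′; _×-dec_)
open import Relation.Nullary.Negation using (contradiction)
open import Relation.Nullary.Reflects using (ofʸ; ofⁿ)
open import Relation.Unary using (Decidable)
open import Defs

private
  variable
    m n k : ℕ

⌊⌋-yes⁻ : ∀ {P : Set} (d : Dec P) → ⌊ d ⌋ ≡ true → P
⌊⌋-yes⁻ (yes p) _ = p

⌊⌋-yes⁺ : ∀ {P : Set} (d : Dec P) → P → ⌊ d ⌋ ≡ true
⌊⌋-yes⁺ (yes _) _ = refl
⌊⌋-yes⁺ (no ¬p) p = ⊥-elim (¬p p)

⌊⌋-no⁺ : ∀ {P : Set} (d : Dec P) → ¬ P → ⌊ d ⌋ ≡ false
⌊⌋-no⁺ (yes p) ¬p = ⊥-elim (¬p p)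
⌊⌋-no⁺ (no _)  _  = refl

∧-true⁻ : ∀ {a b} → a ∧ b ≡ true → a ≡ true × b ≡ true
∧-true⁻ {true} {true} _ = refl , refl

𝟙 : Bool → ℕ
𝟙 true  = 1
𝟙 false = 0

𝟙-∧ : ∀ a b → 𝟙 (a ∧ b) ≡ 𝟙 a * 𝟙 b
𝟙-∧ true  b = sym (+-identityʳ (𝟙 b))
𝟙-∧ false b = refl

𝟙*𝟙≡𝟙 : ∀ a → 𝟙 a * 𝟙 a ≡ 𝟙 a
𝟙*𝟙≡𝟙 true  = refl
𝟙*𝟙≡𝟙 false = refl

δ : ∀ {k} → Fin k → Fin k → ℕ
δ i j = 𝟙 ⌊ i ≟ j ⌋

sumFin≡∑ : ∀ {k} (g : Fin k → ℕ) → sumFin g ≡ ∑[ i < k ] g i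
sumFin≡∑ {zero}  g = refl
sumFin≡∑ {suc k} g = cong (g zero +_) (sumFin≡∑ (λ i → g (suc i)))

∑-mono-≤ : ∀ {k} {g h : Fin k → ℕ} → (∀ i → g i ≤ h i) → ∑[ i < k ] g i ≤ ∑[ i < k ] h i
∑-mono-≤ {zero}  g≤h = z≤n
∑-mono-≤ {suc k} g≤h = +-mono-≤ (g≤h zero) (∑-mono-≤ (λ i → g≤h (suc i)))

∑-δ : ∀ {k} (i : Fin k) (g : Fin k → ℕ) → ∑[ j < k ] (δ i j * g j) ≡ g i
∑-δ {suc k} zero g = begin
  1 * g zero + ∑[ j < k ] 0  ≡⟨ cong₂ _+_ (*-identityˡ (g zero)) (sum-replicate-zero k) ⟩
  g zero + 0                 ≡⟨ +-identityʳ (g zero) ⟩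
  g zero                     ∎
  where open ≡-Reasoning
∑-δ {suc k} (suc i) g = begin
  ∑[ j < k ] (δ (suc i) (suc j) * g (suc j))  ≡⟨ sum-cong-≗ (λ j → cong (λ b → 𝟙 b * g (suc j))
                                                                              (⌊⌋-map′ _ _ (i ≟ j))) ⟩
  ∑[ j < k ] (δ i j * g (suc j))              ≡⟨ ∑-δ i (λ j → g (suc j)) ⟩
  g (suc i)                                   ∎
  where open ≡-Reasoning

∑-fibres : ∀ {m k} (φ : Fin m → Fin k) (g : Fin m → ℕ) →
           ∑[ j < k ] ∑[ x < m ] (δ (φ x) j * g x) ≡ ∑[ x < m ] g x
∑-fibres {m} {k} φ g = begin
  ∑[ j < k ] ∑[ x < m ] (δ (φ x) j * g x)  ≡⟨ ∑-comm (λ x j → δ (φ x) j * g x) ⟨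
  ∑[ x < m ] ∑[ j < k ] (δ (φ x) j * g x)  ≡⟨ sum-cong-≗ (λ x → ∑-δ (φ x) (λ _ → g x)) ⟩
  ∑[ x < m ] g x                           ∎
  where open ≡-Reasoning

∈⇒lookup : ∀ {x} {p : Subset n} → x ∈ p → lookup p x ≡ true
∈⇒lookup = []=⇒lookup

lookup⇒∈ : ∀ {x} {p : Subset n} → lookup p x ≡ true → x ∈ p
lookup⇒∈ {x = x} {p} = lookup⇒[]= x p

∈-tabulate⁺ : ∀ {x} {b : Fin n → Bool} → b x ≡ true → x ∈ tabulate b
∈-tabulate⁺ {b = b} bx = lookup⇒∈ (trans (lookup∘tabulate b _) bx)

∈-tabulate⁻ : ∀ {x} {b : Fin n → Bool} → x ∈ tabulate b → b x ≡ true
∈-tabulate⁻ {b = b} x∈ = trans (sym (lookup∘tabulate b _)) (∈⇒lookup x∈)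

x∈p─q⇒x∉q : ∀ {x} (p q : Subset n) → x ∈ p ─ q → x ∉ q
x∈p─q⇒x∉q (_ ∷ p) (outside ∷ q) here        ()
x∈p─q⇒x∉q (_ ∷ p) (_       ∷ q) (there x∈) (there x∈q) = x∈p─q⇒x∉q p q x∈ x∈q

anyFin⁺ : ∀ (b : Fin k → Bool) i → b i ≡ true → anyFin b ≡ true
anyFin⁺ b zero    bi rewrite bi = refl
anyFin⁺ b (suc i) bi with b zero
... | true  = refl
... | false = anyFin⁺ (b ∘ suc) i bi

anyFin⁻ : ∀ (b : Fin k → Bool) → anyFin b ≡ true → ∃ λ i → b i ≡ true
anyFin⁻ {suc k} b any with b zero in b₀
... | true  = zero , b₀
... | false = let (i , bi) = anyFin⁻ (b ∘ suc) any in suc i , bi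

∪-lub : ∀ {p q r : Subset m} → p ⊆ r → q ⊆ r → p ∪ q ⊆ r
∪-lub {p = p} {q} p⊆r q⊆r x∈p∪q with x∈p∪q⁻ p q x∈p∪q
... | inj₁ x∈p = p⊆r x∈p
... | inj₂ x∈q = q⊆r x∈q

─-monoˡ : ∀ {p q r : Subset m} → p ⊆ q → p ─ r ⊆ q ─ r
─-monoˡ {p = p} {q} {r} p⊆q x∈p─r =
  x∈p∧x∉q⇒x∈p─q (p⊆q (p─q⊆p p r x∈p─r)) (x∈p─q⇒x∉q p r x∈p─r)

∣p∣≡∑𝟙 : (p : Subset n) → ∣ p ∣ ≡ ∑[ x < n ] 𝟙 (lookup p x)
∣p∣≡∑𝟙 []            = refl
∣p∣≡∑𝟙 (inside  ∷ p) = cong suc (∣p∣≡∑𝟙 p)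
∣p∣≡∑𝟙 (outside ∷ p) = ∣p∣≡∑𝟙 p

∣p∩q∣+∣p─q∣≡∣p∣ : (p q : Subset n) → ∣ p ∩ q ∣ + ∣ p ─ q ∣ ≡ ∣ p ∣
∣p∩q∣+∣p─q∣≡∣p∣ []            []            = refl
∣p∩q∣+∣p─q∣≡∣p∣ (inside  ∷ p) (inside  ∷ q) = cong suc (∣p∩q∣+∣p─q∣≡∣p∣ p q)
∣p∩q∣+∣p─q∣≡∣p∣ (inside  ∷ p) (outside ∷ q) = trans (+-suc _ _) (cong suc (∣p∩q∣+∣p─q∣≡∣p∣ p q))
∣p∩q∣+∣p─q∣≡∣p∣ (outside ∷ p) (inside  ∷ q) = ∣p∩q∣+∣p─q∣≡∣p∣ p q
∣p∩q∣+∣p─q∣≡∣p∣ (outside ∷ p) (outside ∷ q) = ∣p∩q∣+∣p─q∣≡∣p∣ p q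

∣p∪q∣+∣p∩q∣≡∣p∣+∣q∣ : (p q : Subset n) → ∣ p ∪ q ∣ + ∣ p ∩ q ∣ ≡ ∣ p ∣ + ∣ q ∣
∣p∪q∣+∣p∩q∣≡∣p∣+∣q∣ []            []            = refl
∣p∪q∣+∣p∩q∣≡∣p∣+∣q∣ (inside  ∷ p) (inside  ∷ q) =
  cong suc (trans (+-suc _ _) (trans (cong suc (∣p∪q∣+∣p∩q∣≡∣p∣+∣q∣ p q)) (sym (+-suc _ _))))
∣p∪q∣+∣p∩q∣≡∣p∣+∣q∣ (inside  ∷ p) (outside ∷ q) = cong suc (∣p∪q∣+∣p∩q∣≡∣p∣+∣q∣ p q)
∣p∪q∣+∣p∩q∣≡∣p∣+∣q∣ (outside ∷ p) (inside  ∷ q) =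
  trans (cong suc (∣p∪q∣+∣p∩q∣≡∣p∣+∣q∣ p q)) (sym (+-suc _ _))
∣p∪q∣+∣p∩q∣≡∣p∣+∣q∣ (outside ∷ p) (outside ∷ q) = ∣p∪q∣+∣p∩q∣≡∣p∣+∣q∣ p q

∣p∣≤𝟙 : ∀ {n} {p : Subset n} {b} → (∀ {x y} → x ∈ p → y ∈ p → x ≡ y) → (∀ {x} → x ∈ p → b ≡ true) →
        ∣ p ∣ ≤ 𝟙 b
∣p∣≤𝟙 {n} {p} subsingleton witness with nonempty? p
... | no ¬ne = subst (_≤ _) (sym (trans (cong ∣_∣ (Empty-unique ¬ne)) (∣⊥∣≡0 n))) z≤n
... | yes (x , x∈p) rewrite witness x∈p = begin
  ∣ p ∣      ≤⟨ p⊆q⇒∣p∣≤∣q∣ (λ y∈p → subst (_∈ ⁅ x ⁆) (subsingleton x∈p y∈p) (x∈⁅x⁆ x)) ⟩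
  ∣ ⁅ x ⁆ ∣  ≡⟨ ∣⁅x⁆∣≡1 x ⟩
  1          ∎
  where open ≤-Reasoning

module _ {S : Subset m} {lab : Fin m → Fin m} {j : Fin m} where

  ∈-block⁺ : ∀ {x} → x ∈ S → lab x ≡ j → x ∈ block S lab j
  ∈-block⁺ {x} x∈S labx≡j = x∈p∩q⁺ (x∈S , ∈-tabulate⁺ (⌊⌋-yes⁺ (lab x ≟ j) labx≡j))

  ∈-block⁻ : ∀ {x} → x ∈ block S lab j → x ∈ S × lab x ≡ j
  ∈-block⁻ {x} x∈B = let (x∈S , x∈L) = x∈p∩q⁻ S _ x∈B in x∈S , ⌊⌋-yes⁻ (lab x ≟ j) (∈-tabulate⁻ x∈L)

  block⊆ : block S lab j ⊆ S
  block⊆ = p∩q⊆p S _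

block-mono : ∀ {S S′ : Subset m} {lab j} → S ⊆ S′ → block S lab j ⊆ block S′ lab j
block-mono S⊆S′ x∈B = let (x∈S , labx≡j) = ∈-block⁻ x∈B in ∈-block⁺ (S⊆S′ x∈S) labx≡j

∑∣block∣≡∣∣ : (S : Subset m) (lab : Fin m → Fin m) → ∑[ j < m ] ∣ block S lab j ∣ ≡ ∣ S ∣
∑∣block∣≡∣∣ {m} S lab = begin
  ∑[ j < m ] ∣ block S lab j ∣                         ≡⟨ sum-cong-≗ (λ j → trans (∣p∣≡∑𝟙 (block S lab j))
                                                                                  (sum-cong-≗ (𝟙-block j))) ⟩
  ∑[ j < m ] ∑[ x < m ] (δ (lab x) j * 𝟙 (lookup S x))  ≡⟨ ∑-fibres lab (λ x → 𝟙 (lookup S x)) ⟩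
  ∑[ x < m ] 𝟙 (lookup S x)                            ≡⟨ ∣p∣≡∑𝟙 S ⟨
  ∣ S ∣                                                ∎
  where
  open ≡-Reasoning
  𝟙-block : ∀ j x → 𝟙 (lookup (block S lab j) x) ≡ δ (lab x) j * 𝟙 (lookup S x)
  𝟙-block j x = begin
    𝟙 (lookup (block S lab j) x)              ≡⟨ cong 𝟙 (lookup-zipWith _∧_ x S _) ⟩
    𝟙 (lookup S x ∧ lookup (tabulate _) x)    ≡⟨ cong (λ b → 𝟙 (lookup S x ∧ b)) (lookup∘tabulate _ x) ⟩
    𝟙 (lookup S x ∧ ⌊ lab x ≟ j ⌋)            ≡⟨ cong 𝟙 (∧-comm (lookup S x) _) ⟩
    𝟙 (⌊ lab x ≟ j ⌋ ∧ lookup S x)            ≡⟨ 𝟙-∧ ⌊ lab x ≟ j ⌋ (lookup S x) ⟩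
    δ (lab x) j * 𝟙 (lookup S x)              ∎

injective⇒∣p∣≤∑∑𝟙 : ∀ (X : Subset m) (φ ψ : Fin m → Fin n) (c : Fin n → Fin n → Bool) →
                     (∀ {e} → e ∈ X → c (φ e) (ψ e) ≡ true) →
                     (∀ {e e′} → e ∈ X → e′ ∈ X → φ e ≡ φ e′ → ψ e ≡ ψ e′ → e ≡ e′) →
                     ∣ X ∣ ≤ ∑[ u < n ] ∑[ w < n ] 𝟙 (c u w)
injective⇒∣p∣≤∑∑𝟙 {m} {n} X φ ψ c c-φψ φψ-injective = begin
  ∣ X ∣                                                       ≡⟨ ∣p∣≡∑𝟙 X ⟩
  ∑[ e < m ] 𝟙 (lookup X e)                                   ≡⟨ ∑-fibres φ (λ e → 𝟙 (lookup X e)) ⟨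
  ∑[ u < n ] ∑[ e < m ] (δ (φ e) u * 𝟙 (lookup X e))          ≡⟨ sum-cong-≗ (λ u →
                                                                   ∑-fibres ψ (λ e → δ (φ e) u * 𝟙 (lookup X e))) ⟨
  ∑[ u < n ] ∑[ w < n ] ∑[ e < m ] (δ (ψ e) w * (δ (φ e) u * 𝟙 (lookup X e)))
                                                              ≡⟨ sum-cong-≗ (λ u → sum-cong-≗ (∣fibre∣≡∑ u)) ⟨
  ∑[ u < n ] ∑[ w < n ] ∣ fibre u w ∣                         ≤⟨ ∑-mono-≤ {n} (λ u → ∑-mono-≤ {n} (λ w →
                                                                   ∣p∣≤𝟙 (fibre-subsingleton u w) (fibre-c u w))) ⟩
  ∑[ u < n ] ∑[ w < n ] 𝟙 (c u w)                             ∎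
  where
  open ≤-Reasoning
  fibre : Fin n → Fin n → Subset m
  fibre u w = tabulate λ e → ⌊ ψ e ≟ w ⌋ ∧ (⌊ φ e ≟ u ⌋ ∧ lookup X e)
  ∣fibre∣≡∑ : ∀ u w → ∣ fibre u w ∣ ≡ ∑[ e < m ] (δ (ψ e) w * (δ (φ e) u * 𝟙 (lookup X e)))
  ∣fibre∣≡∑ u w = trans (∣p∣≡∑𝟙 (fibre u w)) (sum-cong-≗ λ e → begin-equality
    𝟙 (lookup (fibre u w) e)                                ≡⟨ cong 𝟙 (lookup∘tabulate _ e) ⟩
    𝟙 (⌊ ψ e ≟ w ⌋ ∧ (⌊ φ e ≟ u ⌋ ∧ lookup X e))            ≡⟨ 𝟙-∧ ⌊ ψ e ≟ w ⌋ _ ⟩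
    δ (ψ e) w * 𝟙 (⌊ φ e ≟ u ⌋ ∧ lookup X e)               ≡⟨ cong (δ (ψ e) w *_) (𝟙-∧ ⌊ φ e ≟ u ⌋ (lookup X e)) ⟩
    δ (ψ e) w * (δ (φ e) u * 𝟙 (lookup X e))               ∎)
  ∈-fibre⁻ : ∀ {u w e} → e ∈ fibre u w → e ∈ X × φ e ≡ u × ψ e ≡ w
  ∈-fibre⁻ {u} {w} {e} e∈F =
    let (ψe≡w , rest) = ∧-true⁻ (∈-tabulate⁻ e∈F) ; (φe≡u , Xe) = ∧-true⁻ rest in
    lookup⇒∈ Xe , ⌊⌋-yes⁻ (φ e ≟ u) φe≡u , ⌊⌋-yes⁻ (ψ e ≟ w) ψe≡w
  fibre-subsingleton : ∀ u w {e e′} → e ∈ fibre u w → e′ ∈ fibre u w → e ≡ e′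
  fibre-subsingleton u w e∈F e′∈F with ∈-fibre⁻ e∈F | ∈-fibre⁻ e′∈F
  ... | e∈X , φe≡u , ψe≡w | e′∈X , φe′≡u , ψe′≡w =
    φψ-injective e∈X e′∈X (trans φe≡u (sym φe′≡u)) (trans ψe≡w (sym ψe′≡w))
  fibre-c : ∀ u w {e} → e ∈ fibre u w → c u w ≡ true
  fibre-c u w e∈F with ∈-fibre⁻ e∈F
  ... | e∈X , refl , refl = c-φψ e∈X

ordered : Subset n → Fin n → Fin n → Bool
ordered Q u w = lookup Q u ∧ (lookup Q w ∧ ⌊ u Fin.<? w ⌋)

𝟙*𝟙-trichotomy : ∀ (Q : Subset n) u w → 𝟙 (lookup Q u) * 𝟙 (lookup Q w) ≡
                 𝟙 (ordered Q u w) + 𝟙 (ordered Q w u) + δ u w * (𝟙 (lookup Q u) * 𝟙 (lookup Q w))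
𝟙*𝟙-trichotomy Q u w with Fin.<-cmp u w
... | tri< u<w u≢w _
  rewrite ⌊⌋-yes⁺ (u Fin.<? w) u<w | ⌊⌋-no⁺ (w Fin.<? u) (<⇒≯ u<w) | ⌊⌋-no⁺ (u ≟ w) u≢w
  = split (lookup Q u) (lookup Q w)
  where
  split : ∀ a b → 𝟙 a * 𝟙 b ≡ 𝟙 (a ∧ (b ∧ true)) + 𝟙 (b ∧ (a ∧ false)) + 0
  split true  true  = refl
  split true  false = refl
  split false true  = refl
  split false false = refl
... | tri≈ _ refl _
  rewrite ⌊⌋-no⁺ (u Fin.<? u) (<-irrefl refl) | ⌊⌋-yes⁺ (u ≟ u) refl
  = split (lookup Q u)
  where
  split : ∀ a → 𝟙 a * 𝟙 a ≡ 𝟙 (a ∧ (a ∧ false)) + 𝟙 (a ∧ (a ∧ false)) + (𝟙 a * 𝟙 a + 0)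
  split true  = refl
  split false = refl
... | tri> _ u≢w w<u
  rewrite ⌊⌋-no⁺ (u Fin.<? w) (<⇒≯ w<u) | ⌊⌋-yes⁺ (w Fin.<? u) w<u | ⌊⌋-no⁺ (u ≟ w) u≢w
  = split (lookup Q u) (lookup Q w)
  where
  split : ∀ a b → 𝟙 a * 𝟙 b ≡ 𝟙 (a ∧ (b ∧ false)) + 𝟙 (b ∧ (a ∧ true)) + 0
  split true  true  = refl
  split true  false = refl
  split false true  = refl
  split false false = refl

2*∑∑ordered+∣p∣≡∣p∣*∣p∣ : ∀ (Q : Subset n) →
                          2 * ∑[ u < n ] ∑[ w < n ] 𝟙 (ordered Q u w) + ∣ Q ∣ ≡ ∣ Q ∣ * ∣ Q ∣
2*∑∑ordered+∣p∣≡∣p∣*∣p∣ {n} Q = sym (begin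
  ∣ Q ∣ * ∣ Q ∣                                  ≡⟨ cong₂ _*_ (∣p∣≡∑𝟙 Q) (∣p∣≡∑𝟙 Q) ⟩
  (∑[ u < n ] q u) * (∑[ w < n ] q w)            ≡⟨ *-distribʳ-sum (∑[ w < n ] q w) q ⟩
  ∑[ u < n ] (q u * ∑[ w < n ] q w)              ≡⟨ sum-cong-≗ (λ u → *-distribˡ-sum (q u) q) ⟩
  ∑[ u < n ] ∑[ w < n ] (q u * q w)              ≡⟨ sum-cong-≗ (λ u → sum-cong-≗ (𝟙*𝟙-trichotomy Q u)) ⟩
  ∑[ u < n ] ∑[ w < n ] (o u w + o w u + d u w)  ≡⟨ sum-cong-≗ (λ u → ∑-distrib₃ (o u) (λ w → o w u) (d u)) ⟩
  ∑[ u < n ] (∑[ w < n ] o u w + ∑[ w < n ] o w u + ∑[ w < n ] d u w)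
                                                 ≡⟨ ∑-distrib₃ (λ u → ∑[ w < n ] o u w) (λ u → ∑[ w < n ] o w u)
                                                               (λ u → ∑[ w < n ] d u w) ⟩
  N + ∑[ u < n ] ∑[ w < n ] o w u + ∑[ u < n ] ∑[ w < n ] d u w
                                                 ≡⟨ cong₂ (λ a b → N + a + b) (∑-comm (λ u w → o w u))
                                                          (sum-cong-≗ (λ u → ∑-δ u (λ w → q u * q w))) ⟩
  N + N + ∑[ u < n ] (q u * q u)                 ≡⟨ cong (N + N +_) (trans (sum-cong-≗ (λ u → 𝟙*𝟙≡𝟙 (lookup Q u)))
                                                                           (sym (∣p∣≡∑𝟙 Q))) ⟩
  N + N + ∣ Q ∣                                  ≡⟨ cong (λ z → N + z + ∣ Q ∣) (+-identityʳ N) ⟨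
  2 * N + ∣ Q ∣                                  ∎)
  where
  open ≡-Reasoning
  q : Fin n → ℕ
  q u = 𝟙 (lookup Q u)
  o d : Fin n → Fin n → ℕ
  o u w = 𝟙 (ordered Q u w)
  d u w = δ u w * (q u * q w)
  N : ℕ
  N = ∑[ u < n ] ∑[ w < n ] o u w
  ∑-distrib₃ : (g h l : Fin n → ℕ) →
               ∑[ i < n ] (g i + h i + l i) ≡ ∑[ i < n ] g i + ∑[ i < n ] h i + ∑[ i < n ] l i
  ∑-distrib₃ g h l = trans (∑-distrib-+ (λ i → g i + h i) l) (cong (_+ ∑[ i < n ] l i) (∑-distrib-+ g h))

maximum : ∀ {P : Subset m → Set} → Decidable P → ∃ P → ∃ λ A → P A × (∀ {B} → P B → ∣ B ∣ ≤ ∣ A ∣)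
maximum {m} {P} P? (A₀ , pA₀) = go m A₀ pA₀ (m≤n+m m ∣ A₀ ∣)
  where
  go : ∀ k A → P A → m ≤ ∣ A ∣ + k → ∃ λ A → P A × (∀ {B} → P B → ∣ B ∣ ≤ ∣ A ∣)
  go k A pA m≤ with anySubset? (λ B → P? B ×-dec (∣ A ∣ <? ∣ B ∣))
  ... | no ¬larger = A , pA , λ pB → ≮⇒≥ (λ lt → ¬larger (_ , pB , lt))
  go zero    A pA m≤ | yes (B , pB , lt) =
    ⊥-elim (<⇒≱ lt (≤-trans (∣p∣≤n B) (subst (m ≤_) (+-identityʳ _) m≤)))
  go (suc k) A pA m≤ | yes (B , pB , lt) =
    go k B pB (≤-trans m≤ (subst (_≤ ∣ B ∣ + k) (sym (+-suc ∣ A ∣ k)) (+-monoˡ-≤ k lt)))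

greatest : ∀ {P : Subset m → Set} → Decidable P → (∀ {C D} → P C → P D → P (C ∪ D)) →
           ∃ P → ∃ λ M → P M × (∀ {C} → P C → C ⊆ M)
greatest {P = P} P? P-∪ ∃P with maximum P? ∃P
... | M , pM , max = M , pM , contains
  where
  contains : ∀ {C} → P C → C ⊆ M
  contains {C} pC {x} x∈C with x ∈? M
  ... | yes x∈M = x∈M
  ... | no  x∉M = ⊥-elim (<⇒≱ (p⊂q⇒∣p∣<∣q∣ (p⊆p∪q C , x , q⊆p∪q M C x∈C , x∉M)) (max (P-∪ pM pC)))

first : (Fin k → Bool) → Maybe (Fin k)
first {zero}  b = nothing
first {suc k} b = if b zero then just zero else Maybe.map suc (first (b ∘ suc))

first-sound : ∀ (b : Fin k → Bool) {i} → first b ≡ just i → b i ≡ true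
first-sound {suc k} b eq with b zero in b₀ | first (b ∘ suc) in eq′
first-sound {suc k} b refl | true  | _      = b₀
first-sound {suc k} b refl | false | just i = first-sound (b ∘ suc) eq′

first-complete : ∀ (b : Fin k → Bool) {i} → b i ≡ true → ∃ λ j → first b ≡ just j
first-complete {suc k} b {zero}  bi rewrite bi = zero , refl
first-complete {suc k} b {suc i} bi with b zero
... | true  = zero , refl
... | false = let (j , eq) = first-complete (b ∘ suc) bi in suc j , cong (Maybe.map suc) eq

first-cong : ∀ {b c : Fin k → Bool} → (∀ i → b i ≡ c i) → first b ≡ first c
first-cong {zero}  b≗c = refl
first-cong {suc k} b≗c rewrite b≗c zero | first-cong (b≗c ∘ suc) = refl

-- Matroids induced by count functions

module CountMatroid {m : ℕ} (f : Subset m → ℕ)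
  (f-mono : ∀ {P Q} → P ⊆ Q → f P ≤ f Q)
  (f-⊥ : f ⊥ ≡ 0)
  (f-submodular : ∀ P Q → f P < ∣ P ∣ → f Q < ∣ Q ∣ → Nonempty (P ∩ Q) →
                  f (P ∪ Q) + f (P ∩ Q) ≤ f P + f Q)
  where

  indep? : Decidable (Indep f)
  indep? A with anySubset? (λ I → (I ⊆? A) ×-dec (f I <? ∣ I ∣))
  ... | yes (I , I⊆A , violated) = no λ indA → <⇒≱ violated (indA I I⊆A)
  ... | no ¬violated = yes λ I I⊆A → ≮⇒≥ λ violated → ¬violated (I , I⊆A , violated)

  Indep-⊥ : Indep f ⊥
  Indep-⊥ I I⊆⊥ = ≤-trans (p⊆q⇒∣p∣≤∣q∣ I⊆⊥) (subst (_≤ f I) (sym (∣⊥∣≡0 m)) z≤n)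

  Indep-⊆ : ∀ {A B} → B ⊆ A → Indep f A → Indep f B
  Indep-⊆ B⊆A indA I I⊆B = indA I (B⊆A ∘ I⊆B)

  ∣∣≤partSum : ∀ {X Y} → Indep f X → X ⊆ Y → ∀ lab → ∣ X ∣ ≤ partSum f Y lab
  ∣∣≤partSum {X} {Y} indX X⊆Y lab = begin
    ∣ X ∣                            ≡⟨ ∑∣block∣≡∣∣ X lab ⟨
    ∑[ j < m ] ∣ block X lab j ∣     ≤⟨ ∑-mono-≤ {m} (λ j → indX (block X lab j) block⊆) ⟩
    ∑[ j < m ] f (block X lab j)     ≤⟨ ∑-mono-≤ {m} (λ j → f-mono (block-mono X⊆Y)) ⟩
    ∑[ j < m ] f (block Y lab j)     ≡⟨ sumFin≡∑ (λ j → f (block Y lab j)) ⟨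
    partSum f Y lab                  ∎
    where open ≤-Reasoning

  weak-duality : (F : Subset m → ℕ) → (∀ {X Y} → Indep f X → X ⊆ Y → ∣ X ∣ ≤ F Y) →
                 ∀ {B T} → Indep f B → B ⊆ T → ∀ T′ → ∣ B ∣ ≤ ∣ T′ ∣ + F (T ─ T′)
  weak-duality F ∣∣≤F {B} {T} indB B⊆T T′ = begin
    ∣ B ∣                    ≡⟨ ∣p∩q∣+∣p─q∣≡∣p∣ B T′ ⟨
    ∣ B ∩ T′ ∣ + ∣ B ─ T′ ∣  ≤⟨ +-mono-≤ (p⊆q⇒∣p∣≤∣q∣ (p∩q⊆q B T′))
                                        (∣∣≤F (Indep-⊆ (p─q⊆p B T′) indB) (─-monoˡ B⊆T)) ⟩
    ∣ T′ ∣ + F (T ─ T′)      ∎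
    where open ≤-Reasoning

  Tight : Subset m → Subset m → Set
  Tight A X = f X ≤ ∣ X ∩ A ∣

  tight⇒violated : ∀ {A X x} → Tight A X → x ∈ X → x ∉ A → f X < ∣ X ∣
  tight⇒violated {A} {X} tight x∈X x∉A =
    ≤-<-trans tight (p⊂q⇒∣p∣<∣q∣ (p∩q⊆p X A , _ , x∈X , x∉A ∘ proj₂ ∘ x∈p∩q⁻ X A))

  tight-∪ : ∀ {A P Q x y} → Indep f A → Tight A P → Tight A Q →
            x ∈ P → x ∉ A → y ∈ Q → y ∉ A → Nonempty (P ∩ Q) → Tight A (P ∪ Q)
  tight-∪ {A} {P} {Q} indA tightP tightQ x∈P x∉A y∈Q y∉A P∩Q≢∅ = +-cancelʳ-≤ ∣ Y ∣ _ _ (begin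
    f (P ∪ Q) + ∣ Y ∣                ≤⟨ +-monoʳ-≤ _ (≤-trans (indA Y Y⊆A) (f-mono Y⊆P∩Q)) ⟩
    f (P ∪ Q) + f (P ∩ Q)            ≤⟨ f-submodular P Q (tight⇒violated tightP x∈P x∉A)
                                                         (tight⇒violated tightQ y∈Q y∉A) P∩Q≢∅ ⟩
    f P + f Q                        ≤⟨ +-mono-≤ tightP tightQ ⟩
    ∣ P ∩ A ∣ + ∣ Q ∩ A ∣            ≡⟨ ∣p∪q∣+∣p∩q∣≡∣p∣+∣q∣ (P ∩ A) (Q ∩ A) ⟨
    ∣ (P ∩ A) ∪ (Q ∩ A) ∣ + ∣ Y ∣    ≡⟨ cong (λ Z → ∣ Z ∣ + ∣ Y ∣) (∩-distribʳ-∪ A P Q) ⟨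
    ∣ (P ∪ Q) ∩ A ∣ + ∣ Y ∣          ∎)
    where
    open ≤-Reasoning
    Y = (P ∩ A) ∩ (Q ∩ A)
    Y⊆A : Y ⊆ A
    Y⊆A = p∩q⊆q Q A ∘ p∩q⊆q (P ∩ A) (Q ∩ A)
    Y⊆P∩Q : Y ⊆ P ∩ Q
    Y⊆P∩Q x∈Y =
      let (x∈P∩A , x∈Q∩A) = x∈p∩q⁻ _ _ x∈Y in x∈p∩q⁺ (p∩q⊆p P A x∈P∩A , p∩q⊆p Q A x∈Q∩A)

  tight-partition-bound : ∀ {A T T′ lab} → T′ ⊆ A → (∀ j → Tight A (block (T ─ T′) lab j)) →
                          ∣ T′ ∣ + partSum f (T ─ T′) lab ≤ ∣ A ∣
  tight-partition-bound {A} {T} {T′} {lab} T′⊆A tight = begin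
    ∣ T′ ∣ + partSum f (T ─ T′) lab               ≡⟨ cong (∣ T′ ∣ +_) (sumFin≡∑ (λ j → f (block (T ─ T′) lab j))) ⟩
    ∣ T′ ∣ + ∑[ j < m ] f (block (T ─ T′) lab j)   ≤⟨ +-monoʳ-≤ ∣ T′ ∣ (∑-mono-≤ {m} λ j →
                                                        ≤-trans (tight j) (p⊆q⇒∣p∣≤∣q∣ block∩A⊆)) ⟩
    ∣ T′ ∣ + ∑[ j < m ] ∣ block (A ─ T′) lab j ∣   ≡⟨ cong (∣ T′ ∣ +_) (∑∣block∣≡∣∣ (A ─ T′) lab) ⟩
    ∣ T′ ∣ + ∣ A ─ T′ ∣                           ≤⟨ +-monoˡ-≤ _ (p⊆q⇒∣p∣≤∣q∣ λ x∈T′ → x∈p∩q⁺ (T′⊆A x∈T′ , x∈T′)) ⟩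
    ∣ A ∩ T′ ∣ + ∣ A ─ T′ ∣                       ≡⟨ ∣p∩q∣+∣p─q∣≡∣p∣ A T′ ⟩
    ∣ A ∣                                         ∎
    where
    open ≤-Reasoning
    block∩A⊆ : ∀ {j} → block (T ─ T′) lab j ∩ A ⊆ block (A ─ T′) lab j
    block∩A⊆ x∈ = let (x∈B , x∈A) = x∈p∩q⁻ _ A x∈ ; (x∈T─T′ , labx≡j) = ∈-block⁻ x∈B in
      ∈-block⁺ (x∈p∧x∉q⇒x∈p─q x∈A (x∈p─q⇒x∉q T T′ x∈T─T′)) labx≡j

  module MaximalIndependent {T A : Subset m} (A⊆T : A ⊆ T) (indA : Indep f A)
    (maximal : ∀ {e} → e ∈ T → e ∉ A → ¬ Indep f (A ∪ ⁅ e ⁆)) where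

    TightAround : Fin m → Subset m → Set
    TightAround e C = C ⊆ T × e ∈ C × e ∉ A × Tight A C

    tightAround? : ∀ e → Decidable (TightAround e)
    tightAround? e C = (C ⊆? T) ×-dec (e ∈? C) ×-dec ¬? (e ∈? A) ×-dec (f C ≤? ∣ C ∩ A ∣)

    tightAround-∪ : ∀ {e C D} → TightAround e C → TightAround e D → TightAround e (C ∪ D)
    tightAround-∪ {C = C} {D} (C⊆T , e∈C , e∉A , tightC) (D⊆T , e∈D , _ , tightD) =
      ∪-lub C⊆T D⊆T , x∈p∪q⁺ (inj₁ e∈C) , e∉A ,
      tight-∪ indA tightC tightD e∈C e∉A e∈D e∉A (_ , x∈p∩q⁺ (e∈C , e∈D))

    tightAround-exists : ∀ {e} → e ∈ T → e ∉ A → ∃ (TightAround e)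
    tightAround-exists {e} e∈T e∉A with anySubset? (λ I → (I ⊆? A ∪ ⁅ e ⁆) ×-dec (f I <? ∣ I ∣))
    ... | no ¬violated =
      ⊥-elim (maximal e∈T e∉A λ I I⊆ → ≮⇒≥ λ violated → ¬violated (I , I⊆ , violated))
    ... | yes (I , I⊆A+e , violated) = I , I⊆T , e∈I , e∉A , ≤-pred (≤-trans violated ∣I∣≤∣I∩A∣+1)
      where
      I─A⊆e : I ─ A ⊆ ⁅ e ⁆
      I─A⊆e x∈I─A with x∈p∪q⁻ A ⁅ e ⁆ (I⊆A+e (p─q⊆p I A x∈I─A))
      ... | inj₁ x∈A = ⊥-elim (x∈p─q⇒x∉q I A x∈I─A x∈A)
      ... | inj₂ x∈e = x∈e
      I⊆T : I ⊆ T
      I⊆T = ∪-lub A⊆T (λ x∈e → subst (_∈ T) (sym (x∈⁅y⁆⇒x≡y e x∈e)) e∈T) ∘ I⊆A+e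
      e∈I : e ∈ I
      e∈I with e ∈? I
      ... | yes e∈I = e∈I
      ... | no  e∉I = ⊥-elim (<⇒≱ violated (indA I I⊆A))
        where
        I⊆A : I ⊆ A
        I⊆A x∈I with x∈p∪q⁻ A ⁅ e ⁆ (I⊆A+e x∈I)
        ... | inj₁ x∈A = x∈A
        ... | inj₂ x∈e = ⊥-elim (e∉I (subst (_∈ I) (x∈⁅y⁆⇒x≡y e x∈e) x∈I))
      ∣I∣≤∣I∩A∣+1 : ∣ I ∣ ≤ suc ∣ I ∩ A ∣
      ∣I∣≤∣I∩A∣+1 = begin
        ∣ I ∣                    ≡⟨ ∣p∩q∣+∣p─q∣≡∣p∣ I A ⟨
        ∣ I ∩ A ∣ + ∣ I ─ A ∣    ≤⟨ +-monoʳ-≤ ∣ I ∩ A ∣ (≤-trans (p⊆q⇒∣p∣≤∣q∣ I─A⊆e)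
                                                               (≤-reflexive (∣⁅x⁆∣≡1 e))) ⟩
        ∣ I ∩ A ∣ + 1            ≡⟨ +-comm ∣ I ∩ A ∣ 1 ⟩
        suc ∣ I ∩ A ∣            ∎
        where open ≤-Reasoning

    maxTight : Fin m → Subset m
    maxTight e with anySubset? (tightAround? e)
    ... | yes ∃C = proj₁ (greatest (tightAround? e) tightAround-∪ ∃C)
    ... | no  _  = ⊥

    maxTight-around : ∀ {e x} → x ∈ maxTight e → TightAround e (maxTight e)
    maxTight-around {e} x∈M with anySubset? (tightAround? e)
    ... | yes ∃C = proj₁ (proj₂ (greatest (tightAround? e) tightAround-∪ ∃C))
    ... | no  _  = ⊥-elim (∉⊥ x∈M)

    maxTight-greatest : ∀ {e C} → TightAround e C → C ⊆ maxTight e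
    maxTight-greatest {e} {C} aroundC with anySubset? (tightAround? e)
    ... | yes ∃C = proj₂ (proj₂ (greatest (tightAround? e) tightAround-∪ ∃C)) aroundC
    ... | no ¬∃C = ⊥-elim (¬∃C (C , aroundC))

    e∈maxTight : ∀ {e} → e ∈ T → e ∉ A → e ∈ maxTight e
    e∈maxTight e∈T e∉A =
      let (C , aroundC) = tightAround-exists e∈T e∉A in maxTight-greatest aroundC (proj₁ (proj₂ aroundC))

    maxTight-overlap : ∀ {e j x} → x ∈ maxTight e → x ∈ maxTight j → maxTight j ⊆ maxTight e
    maxTight-overlap {e} {j} x∈Me x∈Mj with maxTight-around x∈Me | maxTight-around x∈Mj
    ... | Me⊆T , e∈Me , e∉A , tightMe | Mj⊆T , j∈Mj , j∉A , tightMj =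
      maxTight-greatest {e} (∪-lub Me⊆T Mj⊆T , x∈p∪q⁺ (inj₁ e∈Me) , e∉A ,
                             tight-∪ indA tightMe tightMj e∈Me e∉A j∈Mj j∉A (_ , x∈p∩q⁺ (x∈Me , x∈Mj)))
      ∘ q⊆p∪q (maxTight e) (maxTight j)

    -- Overlapping maxTight sets coincide, so labelling each covered x by the first e with
    -- x ∈ maxTight e partitions T ─ T′ into maxTight sets.
    owner : Fin m → Maybe (Fin m)
    owner x = first (λ e → lookup (maxTight e) x)

    Covered : Subset m
    Covered = tabulate (is-just ∘ owner)

    T′ : Subset m
    T′ = A ─ Covered

    lab : Fin m → Fin m
    lab x = fromMaybe x (owner x)

    owner-covered : ∀ {x} → x ∈ Covered → owner x ≡ just (lab x)
    owner-covered {x} x∈U with owner x | ∈-tabulate⁻ {b = is-just ∘ owner} x∈U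
    ... | just j | _ = refl

    maxTight⇒covered : ∀ {e x} → x ∈ maxTight e → x ∈ Covered
    maxTight⇒covered x∈Me =
      let (_ , owner≡) = first-complete _ (∈⇒lookup x∈Me) in ∈-tabulate⁺ (cong is-just owner≡)

    covered⇒maxTight : ∀ {x} → x ∈ Covered → x ∈ maxTight (lab x)
    covered⇒maxTight x∈U = lookup⇒∈ (first-sound _ (owner-covered x∈U))

    T─T′⊆Covered : T ─ T′ ⊆ Covered
    T─T′⊆Covered {x} x∈T─T′ with x ∈? Covered | x ∈? A
    ... | yes x∈U | _       = x∈U
    ... | no  x∉U | yes x∈A = ⊥-elim (x∈p─q⇒x∉q T T′ x∈T─T′ (x∈p∧x∉q⇒x∈p─q x∈A x∉U))
    ... | no  x∉U | no  x∉A = maxTight⇒covered (e∈maxTight (p─q⊆p T T′ x∈T─T′) x∉A)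

    owner-maxTight : ∀ {j x y} → x ∈ maxTight j → y ∈ maxTight j → owner x ≡ owner y
    owner-maxTight {j} x∈Mj y∈Mj = first-cong λ e → ⇔→≡ (mk⇔
      (λ x∈Me → ∈⇒lookup (maxTight-overlap (lookup⇒∈ x∈Me) x∈Mj y∈Mj))
      (λ y∈Me → ∈⇒lookup (maxTight-overlap (lookup⇒∈ y∈Me) y∈Mj x∈Mj)))

    block≡maxTight : ∀ {j x} → x ∈ block (T ─ T′) lab j → block (T ─ T′) lab j ≡ maxTight j
    block≡maxTight {j} {x} x∈B = ⊆-antisym B⊆M M⊆B
      where
      B⊆M : block (T ─ T′) lab j ⊆ maxTight j
      B⊆M y∈B = let (y∈T─T′ , laby≡j) = ∈-block⁻ y∈B in
        subst (λ i → _ ∈ maxTight i) laby≡j (covered⇒maxTight (T─T′⊆Covered y∈T─T′))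
      laby≡labx : ∀ {y} → y ∈ maxTight j → lab y ≡ lab x
      laby≡labx {y} y∈Mj = cong (fromMaybe y)
        (trans (owner-maxTight y∈Mj (B⊆M x∈B)) (owner-covered (T─T′⊆Covered (proj₁ (∈-block⁻ x∈B)))))
      M⊆B : maxTight j ⊆ block (T ─ T′) lab j
      M⊆B y∈Mj = ∈-block⁺
        (x∈p∧x∉q⇒x∈p─q (proj₁ (maxTight-around y∈Mj) y∈Mj)
                       λ y∈T′ → x∈p─q⇒x∉q A Covered y∈T′ (maxTight⇒covered y∈Mj))
        (trans (laby≡labx y∈Mj) (proj₂ (∈-block⁻ x∈B)))

    tight-partition : ∣ T′ ∣ + partSum f (T ─ T′) lab ≤ ∣ A ∣
    tight-partition = tight-partition-bound (p─q⊆p A Covered) block-tight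
      where
      block-tight : ∀ j → Tight A (block (T ─ T′) lab j)
      block-tight j with nonempty? (block (T ─ T′) lab j)
      ... | yes (_ , x∈B) = subst (Tight A) (sym (block≡maxTight x∈B))
                              (proj₂ (proj₂ (proj₂ (maxTight-around (subst (_ ∈_) (block≡maxTight x∈B) x∈B)))))
      ... | no ¬ne = subst (Tight A) (sym (Empty-unique ¬ne)) (subst (_≤ _) (sym f-⊥) z≤n)

  isMatroid : IsMatroid (Indep f)
  isMatroid = Indep-⊥ , (λ _ _ → Indep-⊆) , augment
    where
    augment : ∀ A B → Indep f A → Indep f B → ∣ A ∣ < ∣ B ∣ →
              ∃ λ e → e ∈ B × e ∉ A × Indep f (A ∪ ⁅ e ⁆)
    augment A B indA indB ∣A∣<∣B∣
      with Fin.any? (λ e → (e ∈? B) ×-dec ¬? (e ∈? A) ×-dec indep? (A ∪ ⁅ e ⁆))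
    ... | yes augmentable = augmentable
    ... | no ¬augmentable = ⊥-elim (<⇒≱ ∣A∣<∣B∣ (begin
      ∣ B ∣                                ≤⟨ weak-duality (λ Y → partSum f Y lab)
                                                           (λ indX X⊆Y → ∣∣≤partSum indX X⊆Y lab)
                                                           indB (q⊆p∪q A B) T′ ⟩
      ∣ T′ ∣ + partSum f (A ∪ B ─ T′) lab  ≤⟨ tight-partition ⟩
      ∣ A ∣                                ∎))
      where
      open ≤-Reasoning
      maximal : ∀ {e} → e ∈ A ∪ B → e ∉ A → ¬ Indep f (A ∪ ⁅ e ⁆)
      maximal {e} e∈A∪B e∉A indA+e with x∈p∪q⁻ A B e∈A∪B
      ... | inj₁ e∈A = e∉A e∈A
      ... | inj₂ e∈B = ¬augmentable (e , e∈B , e∉A , indA+e)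
      open MaximalIndependent (p⊆p∪q B) indA maximal

  record Certificate (T : Subset m) : Set where
    field
      A         : Subset m
      A⊆T       : A ⊆ T
      indA      : Indep f A
      A-maximum : ∀ B → B ⊆ T → Indep f B → ∣ B ∣ ≤ ∣ A ∣
      T′        : Subset m
      T′⊆T      : T′ ⊆ T
      lab       : Fin m → Fin m
      tight     : ∣ T′ ∣ + partSum f (T ─ T′) lab ≤ ∣ A ∣

    isRank : IsRank (Indep f) T ∣ A ∣
    isRank = (A , A⊆T , indA , refl) , A-maximum

  certificate : ∀ T → Certificate T
  certificate T with maximum (λ A → indep? A ×-dec (A ⊆? T)) (⊥ , Indep-⊥ , ⊥⊆)
  ... | A , (indA , A⊆T) , max = record
    { A = A ; A⊆T = A⊆T ; indA = indA ; A-maximum = λ B B⊆T indB → max (indB , B⊆T)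
    ; T′ = T′ ; T′⊆T = A⊆T ∘ p─q⊆p A Covered ; lab = lab ; tight = tight-partition }
    where
    maximal : ∀ {e} → e ∈ T → e ∉ A → ¬ Indep f (A ∪ ⁅ e ⁆)
    maximal {e} e∈T e∉A indA+e =
      <⇒≱ (p⊂q⇒∣p∣<∣q∣ (p⊆p∪q ⁅ e ⁆ , e , x∈p∪q⁺ (inj₂ (x∈⁅x⁆ e)) , e∉A))
          (max (indA+e , ∪-lub A⊆T λ x∈e → subst (_∈ T) (sym (x∈⁅y⁆⇒x≡y e x∈e)) e∈T))
    open MaximalIndependent A⊆T indA maximal

  rank : ∀ T → Σ ℕ λ r → IsRank (Indep f) T r × IsHatPart f T r
  rank T = ∣ A ∣ , isRank , (T′ , T′⊆T , lab , ≤-antisym (upper T′ lab) tight) , λ T″ _ → upper T″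
    where
    open Certificate (certificate T)
    upper : ∀ T″ lab′ → ∣ A ∣ ≤ ∣ T″ ∣ + partSum f (T ─ T″) lab′
    upper T″ lab′ =
      weak-duality (λ Y → partSum f Y lab′) (λ indX X⊆Y → ∣∣≤partSum indX X⊆Y lab′) indA A⊆T T″

  rank-hat : (∀ S lab → f S ≤ partSum f S lab) →
             ∀ T → Σ ℕ λ r → IsRank (Indep f) T r × IsHat f T r
  rank-hat f≤partSum T = ∣ A ∣ , isRank ,
    (T′ , T′⊆T , ≤-antisym (upper T′) (≤-trans (+-monoʳ-≤ ∣ T′ ∣ (f≤partSum (T ─ T′) lab)) tight)) ,
    λ T″ _ → upper T″
    where
    open Certificate (certificate T)
    upper : ∀ T″ → ∣ A ∣ ≤ ∣ T″ ∣ + f (T ─ T″)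
    upper = weak-duality f (λ {X} indX X⊆Y → ≤-trans (indX X (λ x∈X → x∈X)) (f-mono X⊆Y)) indA A⊆T

IsHatPart⇒IsHatD : ∀ {m} {f : Subset m → ℕ} {T h} → IsHatPart f T h → IsHatD f T h
IsHatPart⇒IsHatD {f = f} {T} {h} ((T′ , T′⊆T , lab , h≡) , min) =
  (T′ , T′⊆T , partSum f (T ─ T′) lab , ((lab , refl) , least) , h≡) ,
  λ T″ T″⊆T d ((lab″ , d≡) , _) → subst (λ d → h ≤ ∣ T″ ∣ + d) (sym d≡) (min T″ T″⊆T lab″)
  where
  least : ∀ lab′ → partSum f (T ─ T′) lab ≤ partSum f (T ─ T′) lab′
  least lab′ = +-cancelˡ-≤ ∣ T′ ∣ _ _ (subst (_≤ ∣ T′ ∣ + _) h≡ (min T′ T′⊆T lab′))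

module _ {m : ℕ} (g : Subset m → ℕ) (g-mono : ∀ {P Q} → P ⊆ Q → g P ≤ g Q) (g-⊥ : g ⊥ ≡ 0)
         (g-∪ : ∀ P Q → g (P ∪ Q) ≤ g P + g Q) where

  ⋃-subadditive : ∀ {k} (B : Fin k → Subset m) → g (⋃ (List.tabulate B)) ≤ ∑[ j < k ] g (B j)
  ⋃-subadditive {zero}  B = ≤-reflexive g-⊥
  ⋃-subadditive {suc k} B =
    ≤-trans (g-∪ (B zero) _) (+-monoʳ-≤ (g (B zero)) (⋃-subadditive (B ∘ suc)))

  partition-subadditive : ∀ S lab → g S ≤ partSum g S lab
  partition-subadditive S lab = begin
    g S                                  ≤⟨ g-mono (λ x∈S → ∈-⋃ (block S lab) (∈-block⁺ x∈S refl)) ⟩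
    g (⋃ (List.tabulate (block S lab)))   ≤⟨ ⋃-subadditive (block S lab) ⟩
    ∑[ j < m ] g (block S lab j)         ≡⟨ sumFin≡∑ (λ j → g (block S lab j)) ⟨
    partSum g S lab                      ∎
    where
    open ≤-Reasoning
    ∈-⋃ : ∀ {k} (B : Fin k → Subset m) {j x} → x ∈ B j → x ∈ ⋃ (List.tabulate B)
    ∈-⋃ B {zero}  x∈B = x∈p∪q⁺ (inj₁ x∈B)
    ∈-⋃ B {suc j} x∈B = x∈p∪q⁺ (inj₂ (∈-⋃ (B ∘ suc) x∈B))

-- Looped simple graphs and the count functions f₀ and f₁

2*x+v≤v*v⇒x≤t*v : ∀ {x v t} → 2 * x + v ≤ v * v → v ≤ 2 * t → x ≤ t * v
2*x+v≤v*v⇒x≤t*v {x} {v} {t} count v≤2t = *-cancelˡ-≤ 2 (begin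
  2 * x          ≤⟨ m≤m+n (2 * x) v ⟩
  2 * x + v      ≤⟨ count ⟩
  v * v          ≤⟨ *-monoˡ-≤ v v≤2t ⟩
  2 * t * v      ≡⟨ *-assoc 2 t v ⟩
  2 * (t * v)    ∎)
  where open ≤-Reasoning

v*v+4≤4*v+v : ∀ v → 1 ≤ v → v ≤ 4 → v * v + 4 ≤ 4 * v + v
v*v+4≤4*v+v 1 _ _ = ≤-refl
v*v+4≤4*v+v 2 _ _ = m≤m+n 8 2
v*v+4≤4*v+v 3 _ _ = m≤m+n 13 2
v*v+4≤4*v+v 4 _ _ = ≤-refl
v*v+4≤4*v+v (suc (suc (suc (suc (suc _))))) _ (s≤s (s≤s (s≤s (s≤s ()))))

-- x ≤ (v² − v)/2 ≤ t·v − v/2, which suffices once v ≥ 4; the cases v < 4 are checked by hand.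
2*x+v≤v*v⇒x+2≤t*v : ∀ {x v t} → 2 ≤ t → 1 ≤ v → v ≤ 2 * t → 2 * x + v ≤ v * v → x + 2 ≤ t * v
2*x+v≤v*v⇒x+2≤t*v {x} {v} {t} 2≤t 1≤v v≤2t count = *-cancelˡ-≤ 2 (begin
  2 * (x + 2)    ≡⟨ *-distribˡ-+ 2 x 2 ⟩
  2 * x + 4      ≤⟨ bound (≤-<-connex 4 v) ⟩
  2 * (t * v)    ∎)
  where
  open ≤-Reasoning
  bound : 4 ≤ v ⊎ v < 4 → 2 * x + 4 ≤ 2 * (t * v)
  bound (inj₁ 4≤v) = begin
    2 * x + 4    ≤⟨ +-monoʳ-≤ (2 * x) 4≤v ⟩
    2 * x + v    ≤⟨ count ⟩
    v * v        ≤⟨ *-monoˡ-≤ v v≤2t ⟩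
    2 * t * v    ≡⟨ *-assoc 2 t v ⟩
    2 * (t * v)  ∎
  bound (inj₂ v<4) = begin
    2 * x + 4    ≤⟨ +-cancelʳ-≤ v _ _ (begin
                      2 * x + 4 + v  ≡⟨ xy∙z≈xz∙y (2 * x) 4 v ⟩
                      2 * x + v + 4  ≤⟨ +-monoˡ-≤ 4 count ⟩
                      v * v + 4      ≤⟨ v*v+4≤4*v+v v 1≤v (<⇒≤ v<4) ⟩
                      4 * v + v      ∎) ⟩
    4 * v        ≡⟨ *-assoc 2 2 v ⟩
    2 * (2 * v)  ≤⟨ *-monoʳ-≤ 2 (*-monoˡ-≤ v 2≤t) ⟩
    2 * (t * v)  ∎

a+b≤c+c⇒c<a⇒b<c : ∀ {a b c} → a + b ≤ c + c → c < a → b < c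
a+b≤c+c⇒c<a⇒b<c {a} {b} {c} a+b≤c+c c<a = +-cancelˡ-≤ c (suc b) c (begin
  c + suc b    ≡⟨ +-suc c b ⟩
  suc c + b    ≤⟨ +-monoˡ-≤ b c<a ⟩
  a + b        ≤⟨ a+b≤c+c ⟩
  c + c        ∎)
  where open ≤-Reasoning

ends : ∀ {n} → Link n → Fin n × Fin n
ends (loop w)     = w , w
ends (edge u w _) = u , w

module _ {n m : ℕ} (G : LoopedSimpleGraph n m) where

  V : Subset m → Subset n
  V = VT G

  ∈-V⁺ : ∀ {X e x} → e ∈ X → incident G (link G e) x ≡ true → x ∈ V X
  ∈-V⁺ {X} {e} {x} e∈X inc =
    ∈-tabulate⁺ (anyFin⁺ (λ e → lookup X e ∧ incident G (link G e) x) e (cong₂ _∧_ (∈⇒lookup e∈X) inc))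

  ∈-V⁻ : ∀ {X x} → x ∈ V X → ∃ λ e → e ∈ X × incident G (link G e) x ≡ true
  ∈-V⁻ {X} {x} x∈V =
    let (e , Xe∧inc) = anyFin⁻ (λ e → lookup X e ∧ incident G (link G e) x) (∈-tabulate⁻ x∈V)
        (Xe , inc)   = ∧-true⁻ Xe∧inc
    in e , lookup⇒∈ Xe , inc

  V-mono : ∀ {P Q} → P ⊆ Q → V P ⊆ V Q
  V-mono P⊆Q x∈V = let (e , e∈P , inc) = ∈-V⁻ x∈V in ∈-V⁺ (P⊆Q e∈P) inc

  V-∪ : ∀ P Q → V (P ∪ Q) ⊆ V P ∪ V Q
  V-∪ P Q x∈V with ∈-V⁻ x∈V
  ... | e , e∈P∪Q , inc with x∈p∪q⁻ P Q e∈P∪Q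
  ...   | inj₁ e∈P = x∈p∪q⁺ (inj₁ (∈-V⁺ e∈P inc))
  ...   | inj₂ e∈Q = x∈p∪q⁺ (inj₂ (∈-V⁺ e∈Q inc))

  V-∩ : ∀ P Q → V (P ∩ Q) ⊆ V P ∩ V Q
  V-∩ P Q x∈V = x∈p∩q⁺ (V-mono (p∩q⊆p P Q) x∈V , V-mono (p∩q⊆q P Q) x∈V)

  ∣V∪∣+∣V∩∣≤ : ∀ P Q → ∣ V (P ∪ Q) ∣ + ∣ V (P ∩ Q) ∣ ≤ ∣ V P ∣ + ∣ V Q ∣
  ∣V∪∣+∣V∩∣≤ P Q = ≤-trans (+-mono-≤ (p⊆q⇒∣p∣≤∣q∣ (V-∪ P Q)) (p⊆q⇒∣p∣≤∣q∣ (V-∩ P Q)))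
                           (≤-reflexive (∣p∪q∣+∣p∩q∣≡∣p∣+∣q∣ (V P) (V Q)))

  ∣V⊥∣≡0 : ∣ V ⊥ ∣ ≡ 0
  ∣V⊥∣≡0 = n≤0⇒n≡0 (begin
    ∣ V ⊥ ∣          ≤⟨ p⊆q⇒∣p∣≤∣q∣ {p = V ⊥} {⊥} (λ x∈V → ⊥-elim (∉⊥ (proj₁ (proj₂ (∈-V⁻ x∈V))))) ⟩
    ∣ ⊥ {n = n} ∣    ≡⟨ ∣⊥∣≡0 n ⟩
    0                ∎)
    where open ≤-Reasoning

  incident-ends₁ : ∀ l → incident G l (proj₁ (ends l)) ≡ true
  incident-ends₁ (loop w)     = ⌊⌋-yes⁺ (w ≟ w) refl
  incident-ends₁ (edge u w _) rewrite ⌊⌋-yes⁺ (u ≟ u) refl = refl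

  incident-ends₂ : ∀ l → incident G l (proj₂ (ends l)) ≡ true
  incident-ends₂ (loop w)     = ⌊⌋-yes⁺ (w ≟ w) refl
  incident-ends₂ (edge u w _) rewrite ⌊⌋-yes⁺ (w ≟ w) refl = ∨-zeroʳ _

  1≤∣V∣ : ∀ {X} → Nonempty X → 1 ≤ ∣ V X ∣
  1≤∣V∣ {X} (e , e∈X) = ≤-trans (≤-reflexive (sym (∣⁅x⁆∣≡1 x)))
    (p⊆q⇒∣p∣≤∣q∣ λ y∈x → subst (_∈ V X) (sym (x∈⁅y⁆⇒x≡y x y∈x)) (∈-V⁺ e∈X (incident-ends₁ (link G e))))
    where
    x : Fin n
    x = proj₁ (ends (link G e))

  Loopless : Subset m → Set
  Loopless X = hasLoop G X ≡ false

  loopless⁻ : ∀ {X e} → Loopless X → e ∈ X → isLoop G (link G e) ≡ false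
  loopless⁻ {X} {e} loopless e∈X with isLoop G (link G e) in isLoop-e
  ... | false = refl
  ... | true  = contradiction (trans (sym hasLoop-X) loopless) λ ()
    where
    hasLoop-X : hasLoop G X ≡ true
    hasLoop-X = anyFin⁺ (λ e → lookup X e ∧ isLoop G (link G e)) e (cong₂ _∧_ (∈⇒lookup e∈X) isLoop-e)

  loopless⁺ : ∀ {X} → (∀ {e} → e ∈ X → isLoop G (link G e) ≡ false) → Loopless X
  loopless⁺ {X} edges with hasLoop G X in hasLoop-X
  ... | false = refl
  ... | true  =
    let (e , Xe∧isLoop-e) = anyFin⁻ (λ e → lookup X e ∧ isLoop G (link G e)) hasLoop-X
        (Xe , isLoop-e)   = ∧-true⁻ Xe∧isLoop-e
    in contradiction (trans (sym isLoop-e) (edges (lookup⇒∈ Xe))) λ ()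

  Loopless-⊆ : ∀ {P Q} → P ⊆ Q → Loopless Q → Loopless P
  Loopless-⊆ P⊆Q loopless = loopless⁺ (loopless⁻ loopless ∘ P⊆Q)

  Loopless-∪ : ∀ {P Q} → Loopless P → Loopless Q → Loopless (P ∪ Q)
  Loopless-∪ {P} {Q} loopless-P loopless-Q = loopless⁺ λ e∈P∪Q → case (x∈p∪q⁻ P Q e∈P∪Q)
    where
    case : ∀ {e} → e ∈ P ⊎ e ∈ Q → isLoop G (link G e) ≡ false
    case (inj₁ e∈P) = loopless⁻ loopless-P e∈P
    case (inj₂ e∈Q) = loopless⁻ loopless-Q e∈Q

  Loopless-⊥ : Loopless ⊥
  Loopless-⊥ = loopless⁺ (⊥-elim ∘ ∉⊥)

  edge-ends< : ∀ {l} → isLoop G l ≡ false → proj₁ (ends l) <ᶠ proj₂ (ends l)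
  edge-ends< {edge u w u<w} _ = u<w

  edge-ends-injective : ∀ {l l′} → isLoop G l ≡ false → isLoop G l′ ≡ false → ends l ≡ ends l′ → l ≡ l′
  edge-ends-injective {edge u w u<w} {edge .u .w u<w′} _ _ refl = cong (edge u w) (Fin.<-irrelevant u<w u<w′)

  edge-count : ∀ {X} → Loopless X → 2 * ∣ X ∣ + ∣ V X ∣ ≤ ∣ V X ∣ * ∣ V X ∣
  edge-count {X} loopless = begin
    2 * ∣ X ∣ + ∣ V X ∣                                         ≤⟨ +-monoˡ-≤ ∣ V X ∣ (*-monoʳ-≤ 2 ∣X∣≤pairs) ⟩
    2 * ∑[ u < n ] ∑[ w < n ] 𝟙 (ordered (V X) u w) + ∣ V X ∣   ≡⟨ 2*∑∑ordered+∣p∣≡∣p∣*∣p∣ (V X) ⟩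
    ∣ V X ∣ * ∣ V X ∣                                           ∎
    where
    open ≤-Reasoning
    φ ψ : Fin m → Fin n
    φ e = proj₁ (ends (link G e))
    ψ e = proj₂ (ends (link G e))
    ordered-ends : ∀ {e} → e ∈ X → ordered (V X) (φ e) (ψ e) ≡ true
    ordered-ends {e} e∈X = cong₂ _∧_ (∈⇒lookup (∈-V⁺ e∈X (incident-ends₁ (link G e))))
      (cong₂ _∧_ (∈⇒lookup (∈-V⁺ e∈X (incident-ends₂ (link G e))))
                 (⌊⌋-yes⁺ (φ e Fin.<? ψ e) (edge-ends< (loopless⁻ loopless e∈X))))
    ends-injective : ∀ {e e′} → e ∈ X → e′ ∈ X → φ e ≡ φ e′ → ψ e ≡ ψ e′ → e ≡ e′
    ends-injective e∈X e′∈X φ≡ ψ≡ = link-inj G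
      (edge-ends-injective (loopless⁻ loopless e∈X) (loopless⁻ loopless e′∈X) (cong₂ _,_ φ≡ ψ≡))
    ∣X∣≤pairs : ∣ X ∣ ≤ ∑[ u < n ] ∑[ w < n ] 𝟙 (ordered (V X) u w)
    ∣X∣≤pairs = injective⇒∣p∣≤∑∑𝟙 X φ ψ (ordered (V X)) ordered-ends ends-injective

  v : Subset m → ℕ
  v X = ∣ V X ∣

  v-mono : ∀ {P Q} → P ⊆ Q → v P ≤ v Q
  v-mono P⊆Q = p⊆q⇒∣p∣≤∣q∣ (V-mono P⊆Q)

  tv-mono : ∀ t {P Q} → P ⊆ Q → t * v P ≤ t * v Q
  tv-mono t P⊆Q = *-monoʳ-≤ t (v-mono P⊆Q)

  tv-submodular : ∀ t P Q → t * v (P ∪ Q) + t * v (P ∩ Q) ≤ t * v P + t * v Q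
  tv-submodular t P Q = begin
    t * v (P ∪ Q) + t * v (P ∩ Q)  ≡⟨ *-distribˡ-+ t (v (P ∪ Q)) (v (P ∩ Q)) ⟨
    t * (v (P ∪ Q) + v (P ∩ Q))    ≤⟨ *-monoʳ-≤ t (∣V∪∣+∣V∩∣≤ P Q) ⟩
    t * (v P + v Q)                ≡⟨ *-distribˡ-+ t (v P) (v Q) ⟩
    t * v P + t * v Q              ∎
    where open ≤-Reasoning

  f₀-⊥ : ∀ t → f₀ G t ⊥ ≡ 0
  f₀-⊥ t = trans (cong (t *_) ∣V⊥∣≡0) (*-zeroʳ t)

  f₀-∪ : ∀ t P Q → f₀ G t (P ∪ Q) ≤ f₀ G t P + f₀ G t Q
  f₀-∪ t P Q = ≤-trans (m≤m+n _ _) (tv-submodular t P Q)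

  module _ {t : ℕ} (2≤t : 2 ≤ t) where

    private
      f : Subset m → ℕ
      f = f₁ G t

    data Shape (X : Subset m) (y : ℕ) : Set where
      looped   : hasLoop G X ≡ true → y ≡ t * v X → Shape X y
      sparse   : Loopless X → v X ≤ 2 * t → y ≡ ∣ X ∣ → Shape X y
      critical : Loopless X → v X ≡ 1 + 2 * t → t * v X ≡ y + 1 → Shape X y
      dense    : Loopless X → 1 + 2 * t < v X → y ≡ t * v X → Shape X y

    shape : ∀ X → Shape X (f X)
    shape X with hasLoop G X in hasLoop-X
    ... | true = looped hasLoop-X refl
    ... | false with v X ≤ᵇ 2 * t | ≤ᵇ-reflects-≤ (v X) (2 * t)
    ...   | true  | ofʸ v≤2t = sparse hasLoop-X v≤2t refl
    ...   | false | ofⁿ v≰2t with v X ≤ᵇ 2 * t + 1 | ≤ᵇ-reflects-≤ (v X) (2 * t + 1)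
    ...     | true  | ofʸ v≤2t+1 = critical hasLoop-X v≡1+2t (sym (m∸n+n≡m 1≤tv))
      where
      v≡1+2t : v X ≡ 1 + 2 * t
      v≡1+2t = ≤-antisym (subst (v X ≤_) (+-comm (2 * t) 1) v≤2t+1) (≰⇒> v≰2t)
      1≤tv : 1 ≤ t * v X
      1≤tv = *-mono-≤ (<⇒≤ 2≤t) (subst (1 ≤_) (sym v≡1+2t) (s≤s z≤n))
    ...     | false | ofⁿ v≰2t+1 = dense hasLoop-X (subst (_< v X) (+-comm (2 * t) 1) (≰⇒> v≰2t+1)) refl

    f₁-sparse : ∀ {X} → Loopless X → v X ≤ 2 * t → f X ≡ ∣ X ∣
    f₁-sparse {X} loopless v≤2t with shape X
    ... | looped hasLoop-X _  = contradiction (trans (sym hasLoop-X) loopless) λ ()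
    ... | sparse _ _ f≡       = f≡
    ... | critical _ v≡ _     = contradiction (subst (_≤ 2 * t) v≡ v≤2t) (<⇒≱ ≤-refl)
    ... | dense _ 1+2t<v _    = contradiction (≤-trans v≤2t (n≤1+n _)) (<⇒≱ 1+2t<v)

    f₁-critical : ∀ {X} → Loopless X → v X ≡ 1 + 2 * t → t * v X ≡ f X + 1
    f₁-critical {X} loopless v≡ with shape X
    ... | looped hasLoop-X _  = contradiction (trans (sym hasLoop-X) loopless) λ ()
    ... | sparse _ v≤2t _     = contradiction (subst (_≤ 2 * t) v≡ v≤2t) (<⇒≱ ≤-refl)
    ... | critical _ _ tv≡    = tv≡
    ... | dense _ 1+2t<v _    = contradiction (sym v≡) (<⇒≢ 1+2t<v)

    f₁≤tv : ∀ X → f X ≤ t * v X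
    f₁≤tv X with shape X
    ... | looped _ f≡             = ≤-reflexive f≡
    ... | sparse loopless v≤2t f≡ =
      subst (_≤ t * v X) (sym f≡) (2*x+v≤v*v⇒x≤t*v {∣ X ∣} {v X} {t} (edge-count {X} loopless) v≤2t)
    ... | critical _ _ tv≡        = ≤-trans (m≤m+n _ 1) (≤-reflexive (sym tv≡))
    ... | dense _ _ f≡            = ≤-reflexive f≡

    f₁-gap₂ : ∀ {X} → Loopless X → Nonempty X → v X ≤ 2 * t → f X + 2 ≤ t * v X
    f₁-gap₂ {X} loopless X≢∅ v≤2t = subst (λ y → y + 2 ≤ t * v X) (sym (f₁-sparse loopless v≤2t))
      (2*x+v≤v*v⇒x+2≤t*v {∣ X ∣} {v X} {t} 2≤t (1≤∣V∣ X≢∅) v≤2t (edge-count {X} loopless))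

    f₁-gap₁ : ∀ {X} → Loopless X → Nonempty X → v X ≤ 1 + 2 * t → f X + 1 ≤ t * v X
    f₁-gap₁ {X} loopless X≢∅ v≤1+2t with m≤n⇒m<n∨m≡n v≤1+2t
    ... | inj₁ v<1+2t = ≤-trans (+-monoʳ-≤ (f X) (n≤1+n 1)) (f₁-gap₂ loopless X≢∅ (m<1+n⇒m≤n v<1+2t))
    ... | inj₂ v≡     = ≤-reflexive (sym (f₁-critical loopless v≡))

    f₁-⊥ : f ⊥ ≡ 0
    f₁-⊥ = trans (f₁-sparse Loopless-⊥ (subst (_≤ 2 * t) (sym ∣V⊥∣≡0) z≤n)) (∣⊥∣≡0 m)

    f₁-mono : ∀ {P Q} → P ⊆ Q → f P ≤ f Q
    f₁-mono {P} {Q} P⊆Q with shape Q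
    ... | looped _ f≡ = ≤-trans (f₁≤tv P) (≤-trans (tv-mono t P⊆Q) (≤-reflexive (sym f≡)))
    ... | dense _ _ f≡ = ≤-trans (f₁≤tv P) (≤-trans (tv-mono t P⊆Q) (≤-reflexive (sym f≡)))
    ... | sparse loopless v≤2t f≡ = begin
      f P    ≡⟨ f₁-sparse (Loopless-⊆ P⊆Q loopless) (≤-trans (v-mono P⊆Q) v≤2t) ⟩
      ∣ P ∣  ≤⟨ p⊆q⇒∣p∣≤∣q∣ P⊆Q ⟩
      ∣ Q ∣  ≡⟨ f≡ ⟨
      f Q    ∎
      where open ≤-Reasoning
    ... | critical loopless v≡ tv≡ with nonempty? P
    ...   | yes P≢∅ = +-cancelʳ-≤ 1 (f P) (f Q) (begin
      f P + 1  ≤⟨ f₁-gap₁ (Loopless-⊆ P⊆Q loopless) P≢∅ (≤-trans (v-mono P⊆Q) (≤-reflexive v≡)) ⟩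
      t * v P  ≤⟨ tv-mono t P⊆Q ⟩
      t * v Q  ≡⟨ tv≡ ⟩
      f Q + 1  ∎)
      where open ≤-Reasoning
    ...   | no ¬P≢∅ = subst (λ X → f X ≤ f Q) (sym (Empty-unique ¬P≢∅)) (subst (_≤ f Q) (sym f₁-⊥) z≤n)

    data Defect (X : Subset m) : ℕ → Set where
      full   : t * v X ≡ f X + 0 → Defect X 0
      almost : Loopless X → v X ≡ 1 + 2 * t → t * v X ≡ f X + 1 → Defect X 1

    defect-tv : ∀ {X k} → Defect X k → t * v X ≡ f X + k
    defect-tv (full tv≡)       = tv≡
    defect-tv (almost _ _ tv≡) = tv≡

    violated⇒defect : ∀ {X} → f X < ∣ X ∣ → ∃ (Defect X)
    violated⇒defect {X} violated with shape X
    ... | looped _ f≡               = 0 , full (trans (sym f≡) (sym (+-identityʳ (f X))))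
    ... | sparse _ _ f≡             = contradiction violated (<-irrefl f≡)
    ... | critical loopless v≡ tv≡  = 1 , almost loopless v≡ tv≡
    ... | dense _ _ f≡              = 0 , full (trans (sym f≡) (sym (+-identityʳ (f X))))

    defect-submodular : ∀ {P Q kP kQ cW cI} → Defect P kP → Defect Q kQ → cW + cI ≡ kP + kQ →
                        f (P ∪ Q) + cW ≤ t * v (P ∪ Q) → f (P ∩ Q) + cI ≤ t * v (P ∩ Q) →
                        f (P ∪ Q) + f (P ∩ Q) ≤ f P + f Q
    defect-submodular {P} {Q} {kP} {kQ} {cW} {cI} defP defQ c≡k boundW boundI =
      +-cancelʳ-≤ (kP + kQ) _ _ (begin
        f W + f I + (kP + kQ)     ≡⟨ cong (f W + f I +_) c≡k ⟨
        f W + f I + (cW + cI)     ≡⟨ interchange (f W) (f I) cW cI ⟩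
        (f W + cW) + (f I + cI)   ≤⟨ +-mono-≤ boundW boundI ⟩
        t * v W + t * v I         ≤⟨ tv-submodular t P Q ⟩
        t * v P + t * v Q         ≡⟨ cong₂ _+_ (defect-tv defP) (defect-tv defQ) ⟩
        (f P + kP) + (f Q + kQ)   ≡⟨ interchange (f P) kP (f Q) kQ ⟩
        f P + f Q + (kP + kQ)     ∎)
      where
      open ≤-Reasoning
      W = P ∪ Q
      I = P ∩ Q

    f₁-submodular : ∀ P Q → f P < ∣ P ∣ → f Q < ∣ Q ∣ → Nonempty (P ∩ Q) →
                    f (P ∪ Q) + f (P ∩ Q) ≤ f P + f Q
    f₁-submodular P Q violatedP violatedQ I≢∅ =
      by-defects (proj₂ (violated⇒defect violatedP)) (proj₂ (violated⇒defect violatedQ))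
      where
      W = P ∪ Q
      I = P ∩ Q
      I⊆P : I ⊆ P
      I⊆P = p∩q⊆p P Q
      I⊆Q : I ⊆ Q
      I⊆Q = p∩q⊆q P Q
      f₁+0≤tv : ∀ X → f X + 0 ≤ t * v X
      f₁+0≤tv X = subst (_≤ t * v X) (sym (+-identityʳ (f X))) (f₁≤tv X)
      by-defects : ∀ {kP kQ} → Defect P kP → Defect Q kQ → f W + f I ≤ f P + f Q
      by-defects defP@(full _) defQ@(full _) =
        defect-submodular defP defQ refl (f₁+0≤tv W) (f₁+0≤tv I)
      by-defects defP@(almost looplessP vP≡ _) defQ@(full _) =
        defect-submodular defP defQ refl (f₁+0≤tv W)
          (f₁-gap₁ (Loopless-⊆ I⊆P looplessP) I≢∅ (≤-trans (v-mono I⊆P) (≤-reflexive vP≡)))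
      by-defects defP@(full _) defQ@(almost looplessQ vQ≡ _) =
        defect-submodular defP defQ refl (f₁+0≤tv W)
          (f₁-gap₁ (Loopless-⊆ I⊆Q looplessQ) I≢∅ (≤-trans (v-mono I⊆Q) (≤-reflexive vQ≡)))
      by-defects defP@(almost looplessP vP≡ _) defQ@(almost looplessQ vQ≡ _) with shape W
      ... | looped hasLoop-W _ =
        contradiction (trans (sym hasLoop-W) (Loopless-∪ {P} {Q} looplessP looplessQ)) λ ()
      ... | sparse _ vW≤2t _ =
        contradiction (≤-trans (v-mono {P} {W} (p⊆p∪q Q)) vW≤2t)
                      (subst (λ x → ¬ x ≤ 2 * t) (sym vP≡) (<⇒≱ ≤-refl))
      ... | critical _ _ tv≡ =
        defect-submodular defP defQ refl (≤-reflexive (sym tv≡))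
          (f₁-gap₁ (Loopless-⊆ I⊆P looplessP) I≢∅ (≤-trans (v-mono I⊆P) (≤-reflexive vP≡)))
      ... | dense _ 1+2t<vW _ =
        defect-submodular defP defQ refl (f₁+0≤tv W)
          (f₁-gap₂ (Loopless-⊆ I⊆P looplessP) I≢∅ (m<1+n⇒m≤n (a+b≤c+c⇒c<a⇒b<c vW+vI≤ 1+2t<vW)))
        where
        vW+vI≤ : v W + v I ≤ (1 + 2 * t) + (1 + 2 * t)
        vW+vI≤ = subst₂ (λ a b → v W + v I ≤ a + b) vP≡ vQ≡ (∣V∪∣+∣V∩∣≤ P Q)

theorem3p5 : ∀ {n m : ℕ} (G : LoopedSimpleGraph n m) →
    (∀ (t : ℕ) → 1 ≤ t →
      IsMatroid (Indep (f₀ G t)) ×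
      (∀ (T : Subset m) → Σ ℕ λ r →
        IsRank (Indep (f₀ G t)) T r × IsHat (f₀ G t) T r)) ×
    (∀ (t : ℕ) → 2 ≤ t →
      IsMatroid (Indep (f₁ G t)) ×
      (∀ (T : Subset m) → Σ ℕ λ r →
        IsRank (Indep (f₁ G t)) T r × IsHatD (f₁ G t) T r × IsHatPart (f₁ G t) T r))
theorem3p5 G =
  -- f₀ induces a matroid for every t.
  (λ t _ → let open CountMatroid (f₀ G t) (tv-mono G t) (f₀-⊥ G t) (λ P Q _ _ _ → tv-submodular G t P Q) in
    isMatroid , rank-hat (partition-subadditive (f₀ G t) (tv-mono G t) (f₀-⊥ G t) (f₀-∪ G t))) ,
  (λ t 2≤t → let open CountMatroid (f₁ G t) (f₁-mono G 2≤t) (f₁-⊥ G 2≤t) (f₁-submodular G 2≤t) in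
    isMatroid , λ T → let (r , isRank , isHatPart) = rank T in
                      r , isRank , IsHatPart⇒IsHatD {f = f₁ G t} isHatPart , isHatPart)
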